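{- Let $\mathcal{E}$ be a positive Heyting category with a class of display maps $\mathcal{S}$. Let $\mathcal{S}^{\mathrm{cov}}$ be the class of morphisms of $\mathcal{E}$ that are covered by some morphism in $\mathcal{S}$. Then $\mathcal{S}^{\mathrm{cov}}$ is a class of small maps, and it is the smallest class of small maps containing $\mathcal{S}$.
   Context: A cover is a morphism $f$ such that $f=m\circ g$ with $m$ mono forces $m$ iso. A positive Heyting category: finite limits, every morphism factors as cover followed by mono, covers pullback-stable, disjoint pullback-stable finite coproducts, right adjoints $\forall_f$ to $f^*:\mathrm{Sub}(X)\to\mathrm{Sub}(Y)$. A commutative square with top $A\to B$, left $f:A\to C$, right $g:B\to D$, bottom $p:C\to D$ is a covering square if $p$ is a cover and $A\to C\times_DB$ is a cover; then $f$ covers $g$. Axioms on a class $\mathcal{S}$ of maps: (A1) pullback stability; (A2) descent: if the pullback of $f$ along a cover is in $\mathcal{S}$ then $f\in\mathcal{S}$; (A3) if $X\to Y,X'\to Y'\in\mathcal{S}$ then $X+X'\to Y+Y'\in\mathcal{S}$; (A4) $0\to1,1\to1,1+1\to1\in\mathcal{S}$; (A5) closure under composition; (A6) if $h=g\circ f$ with $f$ a cover and $h\in\mathcal{S}$ then $g\in\mathcal{S}$; (A7) Collection: for any cover $p:Y\to X$ and $f:X\to A\in\mathcal{S}$ there is a covering square with left side $g\in\mathcal{S}$, top map factoring through $p$, right side $f$; (A8) for $f\in\mathcal{S}$, $\forall_f$ maps bounded subobjects (those represented by monos in $\mathcal{S}$) to bounded subobjects; (A9) all diagonals $X\to X\times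 X$ are in $\mathcal{S}$; (A10) if $f=m\circ e$ with $e$ a cover, $m$ mono and $f\in\mathcal{S}$ then $m\in\mathcal{S}$. A class of small maps is a class satisfying (A1)–(A9); a class of display maps is a class satisfying (A1), (A3), (A4), (A5), (A7), (A8), (A9), (A10). -}

module Defs where

open import Level using (Level; _⊔_) renaming (suc to lsuc)
open import Data.Product using (Σ; _×_; _,_; proj₁; Σ-syntax)
open import Relation.Binary.PropositionalEquality using (_≡_; refl)

record Category (o ℓ : Level) : Set (lsuc (o ⊔ ℓ)) where
  infixr 9 _∘_
  field
    Obj       : Set o
    Hom       : Obj → Obj → Set ℓ
    id        : ∀ {A} → Hom A A
    _∘_       : ∀ {A B C} → Hom B C → Hom A B → Hom A C
    identityˡ : ∀ {A B} {f : Hom A B} → id ∘ f ≡ f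
    identityʳ : ∀ {A B} {f : Hom A B} → f ∘ id ≡ f
    assoc     : ∀ {A B C D} {f : Hom A B} {g : Hom B C} {h : Hom C D} →
                (h ∘ g) ∘ f ≡ h ∘ (g ∘ f)

module _ {o ℓ} (𝒞 : Category o ℓ) where
  open Category 𝒞

  Mono : ∀ {A B} → Hom A B → Set (o ⊔ ℓ)
  Mono {A} f = ∀ {Z} (g h : Hom Z A) → f ∘ g ≡ f ∘ h → g ≡ h

  Iso : ∀ {A B} → Hom A B → Set ℓ
  Iso {A} {B} f = Σ[ g ∈ Hom B A ] (g ∘ f ≡ id × f ∘ g ≡ id)

  Cover : ∀ {A B} → Hom A B → Set (o ⊔ ℓ)
  Cover {A} {B} f = ∀ {M} (g : Hom A M) (m : Hom M B) → Mono m → f ≡ m ∘ g → Iso m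

  IsTerminal : Obj → Set (o ⊔ ℓ)
  IsTerminal T = ∀ X → Σ[ t ∈ Hom X T ] (∀ (t' : Hom X T) → t' ≡ t)

  IsInitial : Obj → Set (o ⊔ ℓ)
  IsInitial O = ∀ X → Σ[ t ∈ Hom O X ] (∀ (t' : Hom O X) → t' ≡ t)

  _≤ₕ_ : ∀ {A B X} → Hom A X → Hom B X → Set ℓ
  _≤ₕ_ {A} {B} a b = Σ[ h ∈ Hom A B ] (b ∘ h ≡ a)

  record IsPullback {A B C P} (f : Hom A C) (g : Hom B C)
                    (p₁ : Hom P A) (p₂ : Hom P B) : Set (o ⊔ ℓ) where
    field
      commute      : f ∘ p₁ ≡ g ∘ p₂
      universal    : ∀ {Q} (q₁ : Hom Q A) (q₂ : Hom Q B) → f ∘ q₁ ≡ g ∘ q₂ → Hom Q P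
      universal-p₁ : ∀ {Q} {q₁ : Hom Q A} {q₂ : Hom Q B} (eq : f ∘ q₁ ≡ g ∘ q₂) →
                     p₁ ∘ universal q₁ q₂ eq ≡ q₁
      universal-p₂ : ∀ {Q} {q₁ : Hom Q A} {q₂ : Hom Q B} (eq : f ∘ q₁ ≡ g ∘ q₂) →
                     p₂ ∘ universal q₁ q₂ eq ≡ q₂
      unique       : ∀ {Q} (u v : Hom Q P) → p₁ ∘ u ≡ p₁ ∘ v → p₂ ∘ u ≡ p₂ ∘ v → u ≡ v

  record Pullback {A B C} (f : Hom A C) (g : Hom B C) : Set (o ⊔ ℓ) where
    field
      P          : Obj
      p₁         : Hom P A
      p₂         : Hom P B
      isPullback : IsPullback f g p₁ p₂

  record IsCoproduct {A B S} (i₁ : Hom A S) (i₂ : Hom B S) : Set (o ⊔ ℓ) where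
    field
      [_,_]   : ∀ {Z} → Hom A Z → Hom B Z → Hom S Z
      inject₁ : ∀ {Z} {f : Hom A Z} {g : Hom B Z} → [ f , g ] ∘ i₁ ≡ f
      inject₂ : ∀ {Z} {f : Hom A Z} {g : Hom B Z} → [ f , g ] ∘ i₂ ≡ g
      unique  : ∀ {Z} (u v : Hom S Z) → u ∘ i₁ ≡ v ∘ i₁ → u ∘ i₂ ≡ v ∘ i₂ → u ≡ v

  record SubObj (X : Obj) : Set (o ⊔ ℓ) where
    field
      dom  : Obj
      arr  : Hom dom X
      mono : Mono arr

  record PositiveHeytingCategory : Set (o ⊔ ℓ) where
    field
      ⊤          : Obj
      ⊤-terminal : IsTerminal ⊤
      pullback   : ∀ {A B C} (f : Hom A C) (g : Hom B C) → Pullback f g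
      factor     : ∀ {A B} (f : Hom A B) →
                   Σ[ M ∈ Obj ] Σ[ e ∈ Hom A M ] Σ[ m ∈ Hom M B ]
                     (Cover e × Mono m × f ≡ m ∘ e)
      cover-stable : ∀ {A B C P} {f : Hom A C} {g : Hom B C} {p₁ : Hom P A} {p₂ : Hom P B} →
                     IsPullback f g p₁ p₂ → Cover f → Cover p₂
      ⊥          : Obj
      ⊥-initial  : IsInitial ⊥
      _+_        : Obj → Obj → Obj
      i₁         : ∀ {A B} → Hom A (A + B)
      i₂         : ∀ {A B} → Hom B (A + B)
      coproduct  : ∀ {A B} → IsCoproduct (i₁ {A} {B}) (i₂ {A} {B})
      i₁-mono    : ∀ {A B} → Mono (i₁ {A} {B})
      i₂-mono    : ∀ {A B} → Mono (i₂ {A} {B})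
      disjoint   : ∀ {A B P} (q₁ : Hom P A) (q₂ : Hom P B) →
                   IsPullback (i₁ {A} {B}) i₂ q₁ q₂ → IsInitial P
      -- pullback stability of the empty coproduct
      ⊥-stable   : ∀ {Z} → Hom Z ⊥ → IsInitial Z
      +-stable   : ∀ {A B Z P₁ P₂} (f : Hom Z (A + B))
                     (q₁ : Hom P₁ A) (r₁ : Hom P₁ Z) (q₂ : Hom P₂ B) (r₂ : Hom P₂ Z) →
                   IsPullback i₁ f q₁ r₁ → IsPullback i₂ f q₂ r₂ → IsCoproduct r₁ r₂
      -- ∀_f : Sub(Y) → Sub(X) right adjoint to f* : Sub(X) → Sub(Y), for f : Y → X
      ∀[_]       : ∀ {X Y} (f : Hom Y X) → SubObj Y → SubObj X
      ∀-adjoint  : ∀ {X Y} (f : Hom Y X) (m : SubObj Y) (n : SubObj X) →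
                   ((Pullback.p₂ (pullback (SubObj.arr n) f) ≤ₕ SubObj.arr m →
                       SubObj.arr n ≤ₕ SubObj.arr (∀[ f ] m))
                   × (SubObj.arr n ≤ₕ SubObj.arr (∀[ f ] m) →
                       Pullback.p₂ (pullback (SubObj.arr n) f) ≤ₕ SubObj.arr m))

MapClass : ∀ {o ℓ} → Category o ℓ → (p : Level) → Set (o ⊔ ℓ ⊔ lsuc p)
MapClass 𝒞 p = ∀ {X Y} → Category.Hom 𝒞 X Y → Set p

module _ {o ℓ} (𝒞 : Category o ℓ) (H : PositiveHeytingCategory 𝒞) where
  open Category 𝒞
  open PositiveHeytingCategory H

  _⊆_ : ∀ {p q} → MapClass 𝒞 p → MapClass 𝒞 q → Set (o ⊔ ℓ ⊔ p ⊔ q)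
  S ⊆ T = ∀ {X Y} (f : Hom X Y) → S f → T f

  ! : ∀ X → Hom X ⊤
  ! X = proj₁ (⊤-terminal X)

  ¡ : ∀ X → Hom ⊥ X
  ¡ X = proj₁ (⊥-initial X)

  [_,_]′ : ∀ {A B Z} → Hom A Z → Hom B Z → Hom (A + B) Z
  [ f , g ]′ = IsCoproduct.[_,_] coproduct f g

  _⊕_ : ∀ {X Y X' Y'} → Hom X Y → Hom X' Y' → Hom (X + X') (Y + Y')
  f ⊕ f' = [ i₁ ∘ f , i₂ ∘ f' ]′

  diagonal : ∀ X → Hom X (Pullback.P (pullback (! X) (! X)))
  diagonal X = IsPullback.universal (Pullback.isPullback (pullback (! X) (! X))) id id refl

  -- Covering square:
  --        t
  --    A -----> B
  --  f |        | g
  --    v        v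
  --    C -----> D
  --        p
  record CoveringSquare {A B C D} (t : Hom A B) (f : Hom A C) (g : Hom B D) (p : Hom C D)
         : Set (o ⊔ ℓ) where
    field
      commute    : p ∘ f ≡ g ∘ t
      p-cover    : Cover 𝒞 p
      comparison : Cover 𝒞 (IsPullback.universal
                       (Pullback.isPullback (pullback p g)) f t commute)

  _covers_ : ∀ {A B C D} → Hom A C → Hom B D → Set (o ⊔ ℓ)
  _covers_ {A} {B} {C} {D} f g =
    Σ[ t ∈ Hom A B ] Σ[ p ∈ Hom C D ] CoveringSquare t f g p

  Scov : ∀ {p} → MapClass 𝒞 p → MapClass 𝒞 (o ⊔ ℓ ⊔ p)
  Scov S {B} {D} g = Σ[ A ∈ Obj ] Σ[ C ∈ Obj ] Σ[ f ∈ Hom A C ] (S f × f covers g)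

  Bounded : ∀ {p} → MapClass 𝒞 p → ∀ {Y} → SubObj 𝒞 Y → Set (o ⊔ ℓ ⊔ p)
  Bounded S {Y} m = Σ[ M' ∈ Obj ] Σ[ m' ∈ Hom M' Y ]
    (Mono 𝒞 m' × S m' × _≤ₕ_ 𝒞 (SubObj.arr m) m' × _≤ₕ_ 𝒞 m' (SubObj.arr m))

  module _ {p} (S : MapClass 𝒞 p) where

    A1 : Set (o ⊔ ℓ ⊔ p)
    A1 = ∀ {A B C P} {f : Hom A C} {g : Hom B C} {p₁ : Hom P A} {p₂ : Hom P B} →
         IsPullback 𝒞 f g p₁ p₂ → S f → S p₂

    A2 : Set (o ⊔ ℓ ⊔ p)
    A2 = ∀ {A B C P} {f : Hom A C} {g : Hom B C} {p₁ : Hom P A} {p₂ : Hom P B} →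
         IsPullback 𝒞 f g p₁ p₂ → Cover 𝒞 g → S p₂ → S f

    A3 : Set (o ⊔ ℓ ⊔ p)
    A3 = ∀ {X Y X' Y'} (f : Hom X Y) (f' : Hom X' Y') → S f → S f' → S (f ⊕ f')

    A4 : Set p
    A4 = S (! ⊥) × S (! ⊤) × S (! (⊤ + ⊤))

    A5 : Set (o ⊔ ℓ ⊔ p)
    A5 = ∀ {X Y Z} (f : Hom X Y) (g : Hom Y Z) → S f → S g → S (g ∘ f)

    A6 : Set (o ⊔ ℓ ⊔ p)
    A6 = ∀ {X Y Z} (f : Hom X Y) (g : Hom Y Z) → Cover 𝒞 f → S (g ∘ f) → S g

    A7 : Set (o ⊔ ℓ ⊔ p)
    A7 = ∀ {Y X A} (q : Hom Y X) (f : Hom X A) → Cover 𝒞 q → S f →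
         Σ[ B ∈ Obj ] Σ[ C ∈ Obj ] Σ[ t ∈ Hom B X ] Σ[ g ∈ Hom B C ] Σ[ r ∈ Hom C A ]
           (S g × CoveringSquare t g f r × (Σ[ k ∈ Hom B Y ] (t ≡ q ∘ k)))

    A8 : Set (o ⊔ ℓ ⊔ p)
    A8 = ∀ {X Y} (f : Hom Y X) (m : SubObj 𝒞 Y) → S f → Bounded S m → Bounded S (∀[ f ] m)

    A9 : Set (o ⊔ p)
    A9 = ∀ X → S (diagonal X)

    A10 : Set (o ⊔ ℓ ⊔ p)
    A10 = ∀ {X M Y} (e : Hom X M) (m : Hom M Y) → Cover 𝒞 e → Mono 𝒞 m → S (m ∘ e) → S m

    record IsSmallMaps : Set (o ⊔ ℓ ⊔ p) where
      field
        a1 : A1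
        a2 : A2
        a3 : A3
        a4 : A4
        a5 : A5
        a6 : A6
        a7 : A7
        a8 : A8
        a9 : A9

    record IsDisplayMaps : Set (o ⊔ ℓ ⊔ p) where
      field
        a1  : A1
        a3  : A3
        a4  : A4
        a5  : A5
        a7  : A7
        a8  : A8
        a9  : A9
        a10 : A10

-- Everything is transported along covering squares, which compose, pull back, restrict along
-- pullbacks and add up under +; this gives (A1), (A3), (A4), (A6) and (A9), while descent (A2)
-- holds because a pullback along a cover covers the original map.  For (A5), (A7) and (A8)
-- collection replaces the given cover by a covering square along which the relevant S-map can be
-- restricted; for (A8) moreover (A10) makes the pullback of a covered mono an S-mono, and ∀
-- commutes with pulling back along covering squares.  Minimality: if s ∈ S covers g with bottom
-- cover q, then s = p₁ ∘ κ with κ a cover into the pullback of g along q, so (A6) and then (A2)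
-- put g in any class of small maps containing S.

module Submission where

open import Defs
open import Level using (Level)
open import Data.Product using (_×_)
open import Data.Product using (Σ-syntax; _,_; proj₁; proj₂)
open import Relation.Binary.PropositionalEquality
  using (_≡_; refl; sym; trans; cong; subst; module ≡-Reasoning)

module CategoryLemmas {o ℓ} (𝒞 : Category o ℓ) where
  open Category 𝒞
  open ≡-Reasoning

  pullʳ : ∀ {A B C D} {a : Hom B C} {b : Hom A B} {c : Hom A C} {x : Hom C D} →
          a ∘ b ≡ c → (x ∘ a) ∘ b ≡ x ∘ c
  pullʳ {x = x} e = trans assoc (cong (x ∘_) e)

  pullˡ : ∀ {A B C D} {a : Hom B C} {b : Hom A B} {c : Hom A C} {x : Hom D A} →
          a ∘ b ≡ c → a ∘ (b ∘ x) ≡ c ∘ x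
  pullˡ {x = x} e = trans (sym assoc) (cong (_∘ x) e)

  pushˡ : ∀ {A B C D} {a : Hom B C} {b : Hom A B} {c : Hom A C} {x : Hom D A} →
          c ≡ a ∘ b → c ∘ x ≡ a ∘ (b ∘ x)
  pushˡ e = sym (pullˡ (sym e))

  extendˡ : ∀ {A B B' C D} {a : Hom B C} {b : Hom A B} {c : Hom B' C} {d : Hom A B'} {x : Hom D A} →
            a ∘ b ≡ c ∘ d → a ∘ (b ∘ x) ≡ c ∘ (d ∘ x)
  extendˡ e = trans (pullˡ e) assoc

  extendʳ : ∀ {A B B' C D} {a : Hom B C} {b : Hom A B} {c : Hom B' C} {d : Hom A B'} {x : Hom C D} →
            a ∘ b ≡ c ∘ d → (x ∘ a) ∘ b ≡ (x ∘ c) ∘ d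
  extendʳ e = trans (pullʳ e) (sym assoc)

  id-Iso : ∀ {A} → Iso 𝒞 (id {A})
  id-Iso = id , identityˡ , identityˡ

  Iso⇒Cover : ∀ {A B} {f : Hom A B} → Iso 𝒞 f → Cover 𝒞 f
  Iso⇒Cover (f⁻¹ , _ , ff⁻¹) g m m-mono f≡mg = g ∘ f⁻¹ , left , right
    where
      right : m ∘ (g ∘ f⁻¹) ≡ id
      right = trans (sym assoc) (trans (cong (_∘ f⁻¹) (sym f≡mg)) ff⁻¹)
      left : (g ∘ f⁻¹) ∘ m ≡ id
      left = m-mono _ _ (trans (pullˡ right) (trans identityˡ (sym identityʳ)))

  ≤ₕ-refl : ∀ {A X} {a : Hom A X} → _≤ₕ_ 𝒞 a a
  ≤ₕ-refl = id , identityʳ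

  ≤ₕ-trans : ∀ {A B C X} {a : Hom A X} {b : Hom B X} {c : Hom C X} →
             _≤ₕ_ 𝒞 a b → _≤ₕ_ 𝒞 b c → _≤ₕ_ 𝒞 a c
  ≤ₕ-trans (h , bh≡a) (k , ck≡b) = k ∘ h , trans (sym assoc) (trans (cong (_∘ h) ck≡b) bh≡a)

  ∘-≤ₕ : ∀ {A B X Y} {a : Hom A X} {b : Hom B X} (τ : Hom X Y) → _≤ₕ_ 𝒞 a b → _≤ₕ_ 𝒞 (τ ∘ a) (τ ∘ b)
  ∘-≤ₕ τ (h , bh≡a) = h , trans assoc (cong (τ ∘_) bh≡a)

  IsPullback-resp : ∀ {A B C P} {f f' : Hom A C} {g g' : Hom B C} {p₁ p₁' : Hom P A} {p₂ p₂' : Hom P B} →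
                    f ≡ f' → g ≡ g' → p₁ ≡ p₁' → p₂ ≡ p₂' →
                    IsPullback 𝒞 f g p₁ p₂ → IsPullback 𝒞 f' g' p₁' p₂'
  IsPullback-resp refl refl refl refl pb = pb

  IsPullback-id : ∀ {A C} (f : Hom A C) → IsPullback 𝒞 id f f id
  IsPullback-id f = record
    { commute      = trans identityˡ (sym identityʳ)
    ; universal    = λ _ q₂ _ → q₂
    ; universal-p₁ = λ e → trans (sym e) identityˡ
    ; universal-p₂ = λ _ → identityˡ
    ; unique       = λ u v _ e → trans (sym identityˡ) (trans e identityˡ)
    }

  module _ {A B C P} {f : Hom A C} {g : Hom B C} {p₁ : Hom P A} {p₂ : Hom P B}
           (pb : IsPullback 𝒞 f g p₁ p₂) where
    open IsPullback pb

    IsPullback-swap : IsPullback 𝒞 g f p₂ p₁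
    IsPullback-swap = record
      { commute      = sym commute
      ; universal    = λ q₁ q₂ e → universal q₂ q₁ (sym e)
      ; universal-p₁ = λ e → universal-p₂ (sym e)
      ; universal-p₂ = λ e → universal-p₁ (sym e)
      ; unique       = λ u v e₁ e₂ → unique u v e₂ e₁
      }

    IsPullback-mono : Mono 𝒞 f → Mono 𝒞 p₂
    IsPullback-mono f-mono a b p₂a≡p₂b = unique a b (f-mono _ _ fp₁a≡fp₁b) p₂a≡p₂b
      where
        fp₁a≡fp₁b : f ∘ (p₁ ∘ a) ≡ f ∘ (p₁ ∘ b)
        fp₁a≡fp₁b = begin
          f ∘ (p₁ ∘ a)  ≡⟨ extendˡ commute ⟩
          g ∘ (p₂ ∘ a)  ≡⟨ cong (g ∘_) p₂a≡p₂b ⟩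
          g ∘ (p₂ ∘ b)  ≡⟨ extendˡ (sym commute) ⟩
          f ∘ (p₁ ∘ b)  ∎

    universal-unique : ∀ {Q} {q₁ : Hom Q A} {q₂ : Hom Q B} (e : f ∘ q₁ ≡ g ∘ q₂) (u : Hom Q P) →
                       p₁ ∘ u ≡ q₁ → p₂ ∘ u ≡ q₂ → u ≡ universal q₁ q₂ e
    universal-unique e u p₁u≡q₁ p₂u≡q₂ =
      unique _ _ (trans p₁u≡q₁ (sym (universal-p₁ e))) (trans p₂u≡q₂ (sym (universal-p₂ e)))

  IsPullback-universal-Iso :
    ∀ {A B C P Q} {f : Hom A C} {g : Hom B C} {p₁ : Hom P A} {p₂ : Hom P B} {q₁ : Hom Q A} {q₂ : Hom Q B}
    (pb : IsPullback 𝒞 f g p₁ p₂) (qb : IsPullback 𝒞 f g q₁ q₂) →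
    Iso 𝒞 (IsPullback.universal pb q₁ q₂ (IsPullback.commute qb))
  IsPullback-universal-Iso {p₁ = p₁} {p₂} {q₁} {q₂} pb qb =
    Q.universal p₁ p₂ P.commute ,
    Q.unique _ _ (trans (pullˡ (Q.universal-p₁ _)) (trans (P.universal-p₁ _) (sym identityʳ)))
                 (trans (pullˡ (Q.universal-p₂ _)) (trans (P.universal-p₂ _) (sym identityʳ))) ,
    P.unique _ _ (trans (pullˡ (P.universal-p₁ _)) (trans (Q.universal-p₁ _) (sym identityʳ)))
                 (trans (pullˡ (P.universal-p₂ _)) (trans (Q.universal-p₂ _) (sym identityʳ)))
    where
      module P = IsPullback pb
      module Q = IsPullback qb

  --   Q --q₂--> P --p₂--> B
  --   |q₁       |p₁       |g
  --   A' --h--> A --f---> C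
  module _ {A A' B C P Q} {f : Hom A C} {g : Hom B C} {p₁ : Hom P A} {p₂ : Hom P B}
           {h : Hom A' A} {q₁ : Hom Q A'} {q₂ : Hom Q P}
           (right : IsPullback 𝒞 f g p₁ p₂) where
    private module R = IsPullback right

    IsPullback-glue : IsPullback 𝒞 h p₁ q₁ q₂ → IsPullback 𝒞 (f ∘ h) g q₁ (p₂ ∘ q₂)
    IsPullback-glue left = record
      { commute      = trans assoc (trans (cong (f ∘_) L.commute) (extendˡ R.commute))
      ; universal    = λ x y e → L.universal x (R.universal (h ∘ x) y (trans (sym assoc) e))
                                   (sym (R.universal-p₁ _))
      ; universal-p₁ = λ _ → L.universal-p₁ _
      ; universal-p₂ = λ _ → trans (pullʳ (L.universal-p₂ _)) (R.universal-p₂ _)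
      ; unique       = λ u v e₁ e₂ → L.unique u v e₁ (R.unique _ _
                         (trans (extendˡ (sym L.commute)) (trans (cong (h ∘_) e₁) (extendˡ L.commute)))
                         (trans (sym assoc) (trans e₂ assoc)))
      }
      where module L = IsPullback left

    IsPullback-unglue : h ∘ q₁ ≡ p₁ ∘ q₂ → IsPullback 𝒞 (f ∘ h) g q₁ (p₂ ∘ q₂) → IsPullback 𝒞 h p₁ q₁ q₂
    IsPullback-unglue commute outer = record
      { commute      = commute
      ; universal    = λ x y e → O.universal x (p₂ ∘ y) (outer-commute e)
      ; universal-p₁ = λ e → O.universal-p₁ (outer-commute e)
      ; universal-p₂ = λ e → R.unique _ _
          (trans (extendˡ (sym commute)) (trans (cong (h ∘_) (O.universal-p₁ (outer-commute e))) e))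
          (trans (sym assoc) (O.universal-p₂ (outer-commute e)))
      ; unique       = λ u v e₁ e₂ → O.unique u v e₁ (trans assoc (trans (cong (p₂ ∘_) e₂) (sym assoc)))
      }
      where
        module O = IsPullback outer
        outer-commute : ∀ {Z} {x : Hom Z A'} {y : Hom Z P} → h ∘ x ≡ p₁ ∘ y → (f ∘ h) ∘ x ≡ g ∘ (p₂ ∘ y)
        outer-commute e = trans assoc (trans (cong (f ∘_) e) (extendˡ R.commute))

  IsPullback-same-subobject : ∀ {A B X} {a : Hom A X} {b : Hom B X} → Mono 𝒞 a → Mono 𝒞 b →
                              (a≤b : _≤ₕ_ 𝒞 a b) → _≤ₕ_ 𝒞 b a → IsPullback 𝒞 b id (proj₁ a≤b) a
  IsPullback-same-subobject a-mono b-mono (h , bh≡a) (k , ak≡b) = record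
    { commute      = trans bh≡a (sym identityˡ)
    ; universal    = λ q₁ _ _ → k ∘ q₁
    ; universal-p₁ = λ _ → trans (pullˡ hk≡id) identityˡ
    ; universal-p₂ = λ e → trans (pullˡ ak≡b) (trans e identityˡ)
    ; unique       = λ u v _ e → a-mono u v e
    }
    where
      hk≡id : h ∘ k ≡ id
      hk≡id = b-mono _ _ (trans (pullˡ bh≡a) (trans ak≡b (sym identityʳ)))

  record InverseImage {B Y N M} (τ : Hom B Y) (m : Hom M Y) (μ : Hom N B) : Set (o Level.⊔ ℓ) where
    field
      restricts : _≤ₕ_ 𝒞 (τ ∘ μ) m
      universal : ∀ {Z} (v : Hom Z B) → _≤ₕ_ 𝒞 (τ ∘ v) m → _≤ₕ_ 𝒞 v μ

  IsPullback⇒InverseImage : ∀ {B Y N M M'} {τ : Hom B Y} {m : Hom M Y} {m' : Hom M' Y} {μ : Hom N B}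
                            {x : Hom N M'} → IsPullback 𝒞 τ m' μ x →
                            _≤ₕ_ 𝒞 m m' → _≤ₕ_ 𝒞 m' m → InverseImage τ m μ
  IsPullback⇒InverseImage {x = x} pb m≤m' m'≤m = record
    { restricts = ≤ₕ-trans (x , sym commute) m'≤m
    ; universal = λ v τv≤m → let (y , m'y≡τv) = ≤ₕ-trans τv≤m m≤m' in
                    universal v y (sym m'y≡τv) , universal-p₁ (sym m'y≡τv)
    }
    where open IsPullback pb

module CoveringSquares {o ℓ} (𝒞 : Category o ℓ) (H : PositiveHeytingCategory 𝒞) where
  open Category 𝒞
  open PositiveHeytingCategory H
  open CategoryLemmas 𝒞
  open ≡-Reasoning

  module PB {A B C} (f : Hom A C) (g : Hom B C) where
    open Pullback (pullback f g) public
    open IsPullback isPullback public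

  Cover-lift : ∀ {A B M R} {e : Hom A B} {m : Hom M R} {r : Hom B R} {h : Hom A M} →
               Cover 𝒞 e → Mono 𝒞 m → r ∘ e ≡ m ∘ h → Σ[ d ∈ Hom B M ] (m ∘ d ≡ r)
  Cover-lift {e = e} {m} {r} {h} e-cover m-mono re≡mh = K.p₁ ∘ p₂⁻¹ , (begin
    m ∘ (K.p₁ ∘ p₂⁻¹)  ≡⟨ extendˡ K.commute ⟩
    r ∘ (K.p₂ ∘ p₂⁻¹)  ≡⟨ cong (r ∘_) p₂p₂⁻¹≡id ⟩
    r ∘ id             ≡⟨ identityʳ ⟩
    r                  ∎)
    where
      module K = PB m r
      -- K.p₂ is mono (a pullback of m) and e factors through it, so it is invertible
      p₂-Iso : Iso 𝒞 K.p₂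
      p₂-Iso = e-cover (K.universal h e (sym re≡mh)) K.p₂ (IsPullback-mono K.isPullback m-mono)
                   (sym (K.universal-p₂ _))
      p₂⁻¹ = proj₁ p₂-Iso
      p₂p₂⁻¹≡id : K.p₂ ∘ p₂⁻¹ ≡ id
      p₂p₂⁻¹≡id = proj₂ (proj₂ p₂-Iso)

  Cover-∘ : ∀ {A B C} {f : Hom A B} {g : Hom B C} → Cover 𝒞 f → Cover 𝒞 g → Cover 𝒞 (g ∘ f)
  Cover-∘ f-cover g-cover k m m-mono gf≡mk =
    let (d , md≡g) = Cover-lift f-cover m-mono gf≡mk in g-cover d m m-mono (sym md≡g)

  module _ {A A' B C} (f : Hom A C) (h : Hom A' A) (g : Hom B C) where
    private
      module R = PB f g
      module Q = PB (f ∘ h) g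

    pullback-∘ˡ-map : Hom Q.P R.P
    pullback-∘ˡ-map = R.universal (h ∘ Q.p₁) Q.p₂ (trans (sym assoc) Q.commute)

    pullback-∘ˡ : IsPullback 𝒞 h R.p₁ Q.p₁ pullback-∘ˡ-map
    pullback-∘ˡ = IsPullback-unglue R.isPullback (sym (R.universal-p₁ _))
                    (IsPullback-resp refl refl refl (sym (R.universal-p₂ _)) Q.isPullback)

  module _ {A B B' C} (f : Hom A C) (g : Hom B C) (h : Hom B' B) where
    private
      module R = PB f g
      module Q = PB f (g ∘ h)

    pullback-∘ʳ-map : Hom Q.P R.P
    pullback-∘ʳ-map = R.universal Q.p₁ (h ∘ Q.p₂) (trans Q.commute assoc)

    pullback-∘ʳ : IsPullback 𝒞 h R.p₂ Q.p₂ pullback-∘ʳ-map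
    pullback-∘ʳ = IsPullback-unglue (IsPullback-swap R.isPullback) (sym (R.universal-p₂ _))
                    (IsPullback-resp refl refl refl (sym (R.universal-p₁ _)) (IsPullback-swap Q.isPullback))

  CSq : ∀ {A B C D} (t : Hom A B) (f : Hom A C) (g : Hom B D) (p : Hom C D) → Set (o Level.⊔ ℓ)
  CSq = CoveringSquare 𝒞 H

  -- the comparison map may be computed into any pullback of p and g
  covering-square : ∀ {A B C D Q} {t : Hom A B} {f : Hom A C} {g : Hom B D} {p : Hom C D}
                    {q₁ : Hom Q C} {q₂ : Hom Q B} → p ∘ f ≡ g ∘ t → Cover 𝒞 p →
                    IsPullback 𝒞 p g q₁ q₂ → (u : Hom A Q) → q₁ ∘ u ≡ f → q₂ ∘ u ≡ t → Cover 𝒞 u →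
                    CSq t f g p
  covering-square {t = t} {f} {g} {p} {q₁} {q₂} commute p-cover qb u q₁u≡f q₂u≡t u-cover = record
    { commute    = commute
    ; p-cover    = p-cover
    ; comparison = subst (Cover 𝒞) (sym κ≡iso∘u)
                     (Cover-∘ u-cover (Iso⇒Cover (IsPullback-universal-Iso K.isPullback qb)))
    }
    where
      module K = PB p g
      κ≡iso∘u : K.universal f t commute ≡ K.universal q₁ q₂ (IsPullback.commute qb) ∘ u
      κ≡iso∘u = sym (universal-unique K.isPullback commute _
                  (trans (pullˡ (K.universal-p₁ _)) q₁u≡f) (trans (pullˡ (K.universal-p₂ _)) q₂u≡t))

  pullback-CSq : ∀ {A B C D} {t : Hom A B} {f : Hom A C} {g : Hom B D} {p : Hom C D} →
                 IsPullback 𝒞 p g f t → Cover 𝒞 p → CSq t f g p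
  pullback-CSq pb p-cover =
    covering-square (IsPullback.commute pb) p-cover pb id identityʳ identityʳ (Iso⇒Cover id-Iso)

  id-CSq : ∀ {A C} (f : Hom A C) → CSq id f f id
  id-CSq f = pullback-CSq (IsPullback-id f) (Iso⇒Cover id-Iso)

  ∘-Cover-CSq : ∀ {X Y Z} (f : Hom X Y) (g : Hom Y Z) → Cover 𝒞 f → CSq f (g ∘ f) g id
  ∘-Cover-CSq f g f-cover =
    covering-square identityˡ (Iso⇒Cover id-Iso) (IsPullback-id g) f refl identityˡ f-cover

  CSq-precompose : ∀ {A A' B C D} {t : Hom A B} {f : Hom A C} {g : Hom B D} {p : Hom C D} {e : Hom A' A} →
                   CSq t f g p → Cover 𝒞 e → CSq (t ∘ e) (f ∘ e) g p
  CSq-precompose {t = t} {f} {g} {p} {e} sq e-cover =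
    covering-square (extendˡ sq.commute) sq.p-cover K.isPullback (K.universal f t sq.commute ∘ e)
      (pullˡ (K.universal-p₁ _)) (pullˡ (K.universal-p₂ _)) (Cover-∘ e-cover sq.comparison)
    where
      module sq = CoveringSquare sq
      module K = PB p g

  CSq-∘ : ∀ {A B B' C D D'} {t : Hom A B} {f : Hom A C} {g : Hom B D} {p : Hom C D}
          {t' : Hom B B'} {h : Hom B' D'} {p' : Hom D D'} →
          CSq t f g p → CSq t' g h p' → CSq (t' ∘ t) f h (p' ∘ p)
  CSq-∘ {t = t} {f} {g} {p} {t'} {h} {p'} sq₁ sq₂ =
    covering-square commute (Cover-∘ s₁.p-cover s₂.p-cover) Q.isPullback (v ∘ κ₁)
      (trans (pullˡ (Q.universal-p₁ _)) (P.universal-p₁ _))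
      (trans (pullˡ (Q.universal-p₂ _)) (pullʳ (P.universal-p₂ _)))
      (Cover-∘ s₁.comparison (cover-stable v-pullback s₂.comparison))
    where
      module s₁ = CoveringSquare sq₁
      module s₂ = CoveringSquare sq₂
      module P = PB p g
      module R = PB p' h
      module Q = PB (p' ∘ p) h
      commute : (p' ∘ p) ∘ f ≡ h ∘ (t' ∘ t)
      commute = trans (extendʳ s₁.commute) (trans (cong (_∘ t) s₂.commute) assoc)
      κ₁ = P.universal f t s₁.commute
      κ₂ = R.universal g t' s₂.commute
      v = Q.universal P.p₁ (t' ∘ P.p₂) (trans (extendʳ P.commute) (trans (cong (_∘ P.p₂) s₂.commute) assoc))
      w = pullback-∘ˡ-map p' p h
      v-square : κ₂ ∘ P.p₂ ≡ w ∘ v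
      v-square = R.unique _ _
        (begin
          R.p₁ ∘ (κ₂ ∘ P.p₂)  ≡⟨ pullˡ (R.universal-p₁ _) ⟩
          g ∘ P.p₂            ≡⟨ sym P.commute ⟩
          p ∘ P.p₁            ≡⟨ cong (p ∘_) (sym (Q.universal-p₁ _)) ⟩
          p ∘ (Q.p₁ ∘ v)      ≡⟨ sym (extendˡ (R.universal-p₁ _)) ⟩
          R.p₁ ∘ (w ∘ v)      ∎)
        (begin
          R.p₂ ∘ (κ₂ ∘ P.p₂)  ≡⟨ pullˡ (R.universal-p₂ _) ⟩
          t' ∘ P.p₂           ≡⟨ sym (Q.universal-p₂ _) ⟩
          Q.p₂ ∘ v            ≡⟨ sym (pullˡ (R.universal-p₂ _)) ⟩
          R.p₂ ∘ (w ∘ v)      ∎)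
      v-pullback : IsPullback 𝒞 κ₂ w P.p₂ v
      v-pullback = IsPullback-unglue (IsPullback-swap (pullback-∘ˡ p' p h)) v-square
        (IsPullback-resp (sym (R.universal-p₁ _)) refl refl (sym (Q.universal-p₁ _))
          (IsPullback-swap P.isPullback))

  CSq-pullback : ∀ {A B C D B' D'} {t : Hom A B} {s : Hom A C} {g : Hom B D} {p : Hom C D}
                 {h : Hom D' D} {b₁ : Hom B' B} {g' : Hom B' D'} →
                 CSq t s g p → IsPullback 𝒞 g h b₁ g' →
                 Σ[ t' ∈ Hom (PB.P s (PB.p₁ p h)) B' ] CSq t' (PB.p₂ s (PB.p₁ p h)) g' (PB.p₂ p h)
  CSq-pullback {t = t} {s} {g} {p} {h} {b₁} {g'} sq bpb =
    t' , covering-square t'-commute (cover-stable C'.isPullback sq.p-cover) K'.isPullback u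
           (K'.universal-p₁ _) (K'.universal-p₂ _) (cover-stable u-pullback sq.comparison)
    where
      module sq = CoveringSquare sq
      module b = IsPullback bpb
      module C' = PB p h
      module A' = PB s C'.p₁
      module K = PB p g
      module K' = PB C'.p₂ g'
      t-commute : g ∘ (t ∘ A'.p₁) ≡ h ∘ (C'.p₂ ∘ A'.p₂)
      t-commute = begin
        g ∘ (t ∘ A'.p₁)      ≡⟨ extendˡ (sym sq.commute) ⟩
        p ∘ (s ∘ A'.p₁)      ≡⟨ cong (p ∘_) A'.commute ⟩
        p ∘ (C'.p₁ ∘ A'.p₂)  ≡⟨ extendˡ C'.commute ⟩
        h ∘ (C'.p₂ ∘ A'.p₂)  ∎
      t' = b.universal (t ∘ A'.p₁) (C'.p₂ ∘ A'.p₂) t-commute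
      t'-commute : C'.p₂ ∘ A'.p₂ ≡ g' ∘ t'
      t'-commute = sym (b.universal-p₂ t-commute)
      u = K'.universal A'.p₂ t' t'-commute
      κ = K.universal s t sq.commute
      φ-commute : p ∘ (C'.p₁ ∘ K'.p₁) ≡ g ∘ (b₁ ∘ K'.p₂)
      φ-commute = begin
        p ∘ (C'.p₁ ∘ K'.p₁)  ≡⟨ extendˡ C'.commute ⟩
        h ∘ (C'.p₂ ∘ K'.p₁)  ≡⟨ cong (h ∘_) K'.commute ⟩
        h ∘ (g' ∘ K'.p₂)     ≡⟨ extendˡ (sym b.commute) ⟩
        g ∘ (b₁ ∘ K'.p₂)     ∎
      φ = K.universal (C'.p₁ ∘ K'.p₁) (b₁ ∘ K'.p₂) φ-commute
      φ-pullback : IsPullback 𝒞 C'.p₁ K.p₁ K'.p₁ φ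
      φ-pullback = IsPullback-unglue K.isPullback (sym (K.universal-p₁ _))
        (IsPullback-resp (sym C'.commute) refl refl (sym (K.universal-p₂ _))
          (IsPullback-glue (IsPullback-swap bpb) K'.isPullback))
      u-square : κ ∘ A'.p₁ ≡ φ ∘ u
      u-square = K.unique _ _
        (begin
          K.p₁ ∘ (κ ∘ A'.p₁)   ≡⟨ pullˡ (K.universal-p₁ _) ⟩
          s ∘ A'.p₁            ≡⟨ A'.commute ⟩
          C'.p₁ ∘ A'.p₂        ≡⟨ cong (C'.p₁ ∘_) (sym (K'.universal-p₁ _)) ⟩
          C'.p₁ ∘ (K'.p₁ ∘ u)  ≡⟨ sym (extendˡ (K.universal-p₁ _)) ⟩
          K.p₁ ∘ (φ ∘ u)       ∎)
        (begin
          K.p₂ ∘ (κ ∘ A'.p₁)   ≡⟨ pullˡ (K.universal-p₂ _) ⟩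
          t ∘ A'.p₁            ≡⟨ sym (b.universal-p₁ t-commute) ⟩
          b₁ ∘ t'              ≡⟨ cong (b₁ ∘_) (sym (K'.universal-p₂ _)) ⟩
          b₁ ∘ (K'.p₂ ∘ u)     ≡⟨ sym (extendˡ (K.universal-p₂ _)) ⟩
          K.p₂ ∘ (φ ∘ u)       ∎)
      u-pullback : IsPullback 𝒞 κ φ A'.p₁ u
      u-pullback = IsPullback-unglue (IsPullback-swap φ-pullback) u-square
        (IsPullback-resp (sym (K.universal-p₁ _)) refl refl (sym (K'.universal-p₁ _)) A'.isPullback)

  CSq-restrictʳ : ∀ {A B C D X X'} {t : Hom A B} {f : Hom A C} {g : Hom B D} {p : Hom C D}
                  {g' : Hom X B} {x₁ : Hom X' X} {f' : Hom X' A} →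
                  CSq t f g p → IsPullback 𝒞 g' t x₁ f' → CSq x₁ (f ∘ f') (g ∘ g') p
  CSq-restrictʳ {t = t} {f} {g} {p} {g'} {x₁} {f'} sq xpb =
    covering-square commute sq.p-cover K'.isPullback u (K'.universal-p₁ _) (K'.universal-p₂ _)
      (cover-stable u-pullback sq.comparison)
    where
      module sq = CoveringSquare sq
      module x = IsPullback xpb
      module K = PB p g
      module K' = PB p (g ∘ g')
      commute : p ∘ (f ∘ f') ≡ (g ∘ g') ∘ x₁
      commute = trans (extendˡ sq.commute) (trans (cong (g ∘_) (sym x.commute)) (sym assoc))
      u = K'.universal (f ∘ f') x₁ commute
      κ = K.universal f t sq.commute
      ψ = pullback-∘ʳ-map p g g'
      u-square : κ ∘ f' ≡ ψ ∘ u
      u-square = K.unique _ _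
        (begin
          K.p₁ ∘ (κ ∘ f')      ≡⟨ pullˡ (K.universal-p₁ _) ⟩
          f ∘ f'               ≡⟨ sym (K'.universal-p₁ _) ⟩
          K'.p₁ ∘ u            ≡⟨ sym (pullˡ (K.universal-p₁ _)) ⟩
          K.p₁ ∘ (ψ ∘ u)       ∎)
        (begin
          K.p₂ ∘ (κ ∘ f')      ≡⟨ pullˡ (K.universal-p₂ _) ⟩
          t ∘ f'               ≡⟨ sym x.commute ⟩
          g' ∘ x₁              ≡⟨ cong (g' ∘_) (sym (K'.universal-p₂ _)) ⟩
          g' ∘ (K'.p₂ ∘ u)     ≡⟨ sym (extendˡ (K.universal-p₂ _)) ⟩
          K.p₂ ∘ (ψ ∘ u)       ∎)
      u-pullback : IsPullback 𝒞 κ ψ f' u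
      u-pullback = IsPullback-unglue (IsPullback-swap (pullback-∘ʳ p g g')) u-square
        (IsPullback-resp (sym (K.universal-p₂ _)) refl refl (sym (K'.universal-p₂ _)) (IsPullback-swap xpb))

  comparison-restrictˡ : ∀ {A B C D C' A'} {t : Hom A B} {f : Hom A C} {g : Hom B D} {p : Hom C D}
                         {k : Hom C' C} {a₁ : Hom A' A} {f' : Hom A' C'} →
                         CSq t f g p → IsPullback 𝒞 f k a₁ f' →
                         Σ[ e ∈ (p ∘ k) ∘ f' ≡ g ∘ (t ∘ a₁) ] Cover 𝒞 (PB.universal (p ∘ k) g f' (t ∘ a₁) e)
  comparison-restrictˡ {t = t} {f} {g} {p} {k} {a₁} {f'} sq apb =
    commute , cover-stable u-pullback sq.comparison
    where
      module sq = CoveringSquare sq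
      module a = IsPullback apb
      module K = PB p g
      module K' = PB (p ∘ k) g
      commute : (p ∘ k) ∘ f' ≡ g ∘ (t ∘ a₁)
      commute = trans assoc (trans (cong (p ∘_) (sym a.commute)) (extendˡ sq.commute))
      u = K'.universal f' (t ∘ a₁) commute
      κ = K.universal f t sq.commute
      ψ = pullback-∘ˡ-map p k g
      u-square : κ ∘ a₁ ≡ ψ ∘ u
      u-square = K.unique _ _
        (begin
          K.p₁ ∘ (κ ∘ a₁)      ≡⟨ pullˡ (K.universal-p₁ _) ⟩
          f ∘ a₁               ≡⟨ a.commute ⟩
          k ∘ f'               ≡⟨ cong (k ∘_) (sym (K'.universal-p₁ _)) ⟩
          k ∘ (K'.p₁ ∘ u)      ≡⟨ sym (extendˡ (K.universal-p₁ _)) ⟩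
          K.p₁ ∘ (ψ ∘ u)       ∎)
        (begin
          K.p₂ ∘ (κ ∘ a₁)      ≡⟨ pullˡ (K.universal-p₂ _) ⟩
          t ∘ a₁               ≡⟨ sym (K'.universal-p₂ _) ⟩
          K'.p₂ ∘ u            ≡⟨ sym (pullˡ (K.universal-p₂ _)) ⟩
          K.p₂ ∘ (ψ ∘ u)       ∎)
      u-pullback : IsPullback 𝒞 κ ψ a₁ u
      u-pullback = IsPullback-unglue (IsPullback-swap (pullback-∘ˡ p k g)) u-square
        (IsPullback-resp (sym (K.universal-p₁ _)) refl refl (sym (K'.universal-p₁ _)) apb)

  _⊕′_ : ∀ {X Y X' Y'} → Hom X Y → Hom X' Y' → Hom (X + X') (Y + Y')
  _⊕′_ = _⊕_ 𝒞 H

  ⊕-i₁ : ∀ {X Y X' Y'} {f : Hom X Y} {f' : Hom X' Y'} → (f ⊕′ f') ∘ i₁ ≡ i₁ ∘ f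
  ⊕-i₁ = IsCoproduct.inject₁ coproduct

  ⊕-i₂ : ∀ {X Y X' Y'} {f : Hom X Y} {f' : Hom X' Y'} → (f ⊕′ f') ∘ i₂ ≡ i₂ ∘ f'
  ⊕-i₂ = IsCoproduct.inject₂ coproduct

  ⊕-square : ∀ {A C X Y A' C' X' Y'} {s : Hom A C} {p : Hom C Y} {t : Hom A X} {f : Hom X Y}
             {s' : Hom A' C'} {p' : Hom C' Y'} {t' : Hom A' X'} {f' : Hom X' Y'} →
             p ∘ s ≡ f ∘ t → p' ∘ s' ≡ f' ∘ t' → (p ⊕′ p') ∘ (s ⊕′ s') ≡ (f ⊕′ f') ∘ (t ⊕′ t')
  ⊕-square {s = s} {p} {t} {f} {s'} {p'} {t'} {f'} ps≡ft p's'≡f't' = IsCoproduct.unique coproduct _ _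
    (begin
      ((p ⊕′ p') ∘ (s ⊕′ s')) ∘ i₁  ≡⟨ pullʳ ⊕-i₁ ⟩
      (p ⊕′ p') ∘ (i₁ ∘ s)          ≡⟨ extendˡ ⊕-i₁ ⟩
      i₁ ∘ (p ∘ s)                  ≡⟨ cong (i₁ ∘_) ps≡ft ⟩
      i₁ ∘ (f ∘ t)                  ≡⟨ sym (extendˡ ⊕-i₁) ⟩
      (f ⊕′ f') ∘ (i₁ ∘ t)          ≡⟨ sym (pullʳ ⊕-i₁) ⟩
      ((f ⊕′ f') ∘ (t ⊕′ t')) ∘ i₁  ∎)
    (begin
      ((p ⊕′ p') ∘ (s ⊕′ s')) ∘ i₂  ≡⟨ pullʳ ⊕-i₂ ⟩
      (p ⊕′ p') ∘ (i₂ ∘ s')         ≡⟨ extendˡ ⊕-i₂ ⟩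
      i₂ ∘ (p' ∘ s')                ≡⟨ cong (i₂ ∘_) p's'≡f't' ⟩
      i₂ ∘ (f' ∘ t')                ≡⟨ sym (extendˡ ⊕-i₂) ⟩
      (f ⊕′ f') ∘ (i₂ ∘ t')         ≡⟨ sym (pullʳ ⊕-i₂) ⟩
      ((f ⊕′ f') ∘ (t ⊕′ t')) ∘ i₂  ∎)

  Initial-≡ : ∀ {Z} → IsInitial 𝒞 Z → ∀ {X} (a b : Hom Z X) → a ≡ b
  Initial-≡ Z-initial a b = trans (proj₂ (Z-initial _) a) (sym (proj₂ (Z-initial _) b))

  injections-disjoint : ∀ {A B Z} {x : Hom Z A} {y : Hom Z B} → i₁ ∘ x ≡ i₂ ∘ y → IsInitial 𝒞 Z
  injections-disjoint {A} {B} e = ⊥-stable (proj₁ (D-initial ⊥) ∘ D.universal _ _ e)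
    where
      module D = PB (i₁ {A} {B}) i₂
      D-initial : IsInitial 𝒞 D.P
      D-initial = disjoint D.p₁ D.p₂ D.isPullback

  module _ {C C'} {Z} (z : Hom Z (C + C')) where
    private
      module Z₁ = PB (i₁ {C} {C'}) z
      module Z₂ = PB (i₂ {C} {C'}) z
      Z-coproduct : IsCoproduct 𝒞 Z₁.p₂ Z₂.p₂
      Z-coproduct = +-stable z Z₁.p₁ Z₁.p₂ Z₂.p₁ Z₂.p₂ Z₁.isPullback Z₂.isPullback
      module Zc = IsCoproduct Z-coproduct

    factor-i₁ : IsInitial 𝒞 Z₂.P → Σ[ c ∈ Hom Z C ] (i₁ ∘ c ≡ z)
    factor-i₁ Z₂-initial = Zc.[ Z₁.p₁ , proj₁ (Z₂-initial _) ] ,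
      Zc.unique _ _ (trans (pullʳ Zc.inject₁) Z₁.commute) (Initial-≡ Z₂-initial _ _)

    factor-i₂ : IsInitial 𝒞 Z₁.P → Σ[ c ∈ Hom Z C' ] (i₂ ∘ c ≡ z)
    factor-i₂ Z₁-initial = Zc.[ proj₁ (Z₁-initial _) , Z₂.p₁ ] ,
      Zc.unique _ _ (Initial-≡ Z₁-initial _ _) (trans (pullʳ Zc.inject₂) Z₂.commute)

    ⊕-factor-i₁ : ∀ {Y Y'} (a : Hom C Y) (a' : Hom C' Y') {w : Hom Z Y} →
                  (a ⊕′ a') ∘ z ≡ i₁ ∘ w → Σ[ c ∈ Hom Z C ] (i₁ ∘ c ≡ z)
    ⊕-factor-i₁ a a' {w} e = factor-i₁ (injections-disjoint (begin
      i₁ ∘ (w ∘ Z₂.p₂)            ≡⟨ extendˡ (sym e) ⟩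
      (a ⊕′ a') ∘ (z ∘ Z₂.p₂)     ≡⟨ cong ((a ⊕′ a') ∘_) (sym Z₂.commute) ⟩
      (a ⊕′ a') ∘ (i₂ ∘ Z₂.p₁)    ≡⟨ extendˡ ⊕-i₂ ⟩
      i₂ ∘ (a' ∘ Z₂.p₁)           ∎))

    ⊕-factor-i₂ : ∀ {Y Y'} (a : Hom C Y) (a' : Hom C' Y') {w : Hom Z Y'} →
                  (a ⊕′ a') ∘ z ≡ i₂ ∘ w → Σ[ c ∈ Hom Z C' ] (i₂ ∘ c ≡ z)
    ⊕-factor-i₂ a a' {w} e = factor-i₂ (injections-disjoint (begin
      i₁ ∘ (a ∘ Z₁.p₁)            ≡⟨ extendˡ (sym ⊕-i₁) ⟩
      (a ⊕′ a') ∘ (i₁ ∘ Z₁.p₁)    ≡⟨ cong ((a ⊕′ a') ∘_) Z₁.commute ⟩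
      (a ⊕′ a') ∘ (z ∘ Z₁.p₂)     ≡⟨ extendˡ e ⟩
      i₂ ∘ (w ∘ Z₁.p₂)            ∎))

  record CoveredThrough {V Q E} (r : Hom V Q) (κ : Hom E Q) : Set (o Level.⊔ ℓ) where
    field
      {W}     : Obj
      e       : Hom W V
      h       : Hom W E
      e-cover : Cover 𝒞 e
      commute : r ∘ e ≡ κ ∘ h

  Cover-from-summands : ∀ {V₁ V₂ Q E} {r₁ : Hom V₁ Q} {r₂ : Hom V₂ Q} → IsCoproduct 𝒞 r₁ r₂ →
                        (κ : Hom E Q) → CoveredThrough r₁ κ → CoveredThrough r₂ κ → Cover 𝒞 κ
  Cover-from-summands cop κ c₁ c₂ g m m-mono κ≡mg = [ d₁ , d₂ ] , left , right
    where
      open IsCoproduct cop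
      module c₁ = CoveredThrough c₁
      module c₂ = CoveredThrough c₂
      lift₁ = Cover-lift c₁.e-cover m-mono (trans c₁.commute (trans (cong (_∘ c₁.h) κ≡mg) assoc))
      lift₂ = Cover-lift c₂.e-cover m-mono (trans c₂.commute (trans (cong (_∘ c₂.h) κ≡mg) assoc))
      d₁ = proj₁ lift₁
      d₂ = proj₁ lift₂
      right : m ∘ [ d₁ , d₂ ] ≡ id
      right = unique _ _
        (trans (pullʳ inject₁) (trans (proj₂ lift₁) (sym identityˡ)))
        (trans (pullʳ inject₂) (trans (proj₂ lift₂) (sym identityˡ)))
      left : [ d₁ , d₂ ] ∘ m ≡ id
      left = m-mono _ _ (trans (pullˡ right) (trans identityˡ (sym identityʳ)))

  Cover-⊕ : ∀ {C C' Y Y'} {p : Hom C Y} {p' : Hom C' Y'} → Cover 𝒞 p → Cover 𝒞 p' → Cover 𝒞 (p ⊕′ p')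
  Cover-⊕ {p = p} {p'} p-cover p'-cover = Cover-from-summands coproduct (p ⊕′ p')
    (record { e = p ; h = i₁ ; e-cover = p-cover ; commute = sym ⊕-i₁ })
    (record { e = p' ; h = i₂ ; e-cover = p'-cover ; commute = sym ⊕-i₂ })

  -- (jA, jC, jX, jY) maps the covering square (t, s, f, p) into one summand of the square
  -- (Sg, Tt, F, P); the part of the comparison target of the latter lying over that summand is
  -- then covered through its comparison map.
  summand-comparison-covered :
    ∀ {A C X Y AA CC XX YY} {t : Hom A X} {s : Hom A C} {f : Hom X Y} {p : Hom C Y}
    {jA : Hom A AA} {jC : Hom C CC} {jX : Hom X XX} {jY : Hom Y YY}
    {Sg : Hom AA CC} {Tt : Hom AA XX} {F : Hom XX YY} {P : Hom CC YY} →
    CSq t s f p → Mono 𝒞 jY →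
    P ∘ jC ≡ jY ∘ p → F ∘ jX ≡ jY ∘ f → Sg ∘ jA ≡ jC ∘ s → Tt ∘ jA ≡ jX ∘ t →
    (cQ : P ∘ Sg ≡ F ∘ Tt) →
    (∀ {Z} (z : Hom Z CC) {w : Hom Z Y} → P ∘ z ≡ jY ∘ w → Σ[ c ∈ Hom Z C ] (jC ∘ c ≡ z)) →
    CoveredThrough (PB.p₂ jX (PB.p₂ P F)) (PB.universal P F Sg Tt cQ)
  summand-comparison-covered {t = t} {s} {f} {p} {jA} {jC} {jX} {jY} {Sg} {Tt} {F} {P}
    sq jY-mono eP eF eS eT cQ factors-through-jC =
    record { e = W.p₂ ; h = jA ∘ W.p₁ ; e-cover = cover-stable W.isPullback sq.comparison ; commute = Q.unique _ _
      (begin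
        Q.p₁ ∘ (V.p₂ ∘ W.p₂)        ≡⟨ extendˡ (sym jCc≡) ⟩
        jC ∘ (c ∘ W.p₂)             ≡⟨ cong (jC ∘_) cW≡sW ⟩
        jC ∘ (s ∘ W.p₁)             ≡⟨ extendˡ (sym eS) ⟩
        Sg ∘ (jA ∘ W.p₁)            ≡⟨ sym (pullˡ (Q.universal-p₁ cQ)) ⟩
        Q.p₁ ∘ (κQ ∘ (jA ∘ W.p₁))   ∎)
      (begin
        Q.p₂ ∘ (V.p₂ ∘ W.p₂)        ≡⟨ extendˡ (sym V.commute) ⟩
        jX ∘ (V.p₁ ∘ W.p₂)          ≡⟨ cong (jX ∘_) vW≡tW ⟩
        jX ∘ (t ∘ W.p₁)             ≡⟨ extendˡ (sym eT) ⟩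
        Tt ∘ (jA ∘ W.p₁)            ≡⟨ sym (pullˡ (Q.universal-p₂ cQ)) ⟩
        Q.p₂ ∘ (κQ ∘ (jA ∘ W.p₁))   ∎) }
    where
      module sq = CoveringSquare sq
      module Q = PB P F
      module V = PB jX Q.p₂
      module K = PB p f
      κQ = Q.universal Sg Tt cQ
      PQV≡jYfV : P ∘ (Q.p₁ ∘ V.p₂) ≡ jY ∘ (f ∘ V.p₁)
      PQV≡jYfV = begin
        P ∘ (Q.p₁ ∘ V.p₂)   ≡⟨ extendˡ Q.commute ⟩
        F ∘ (Q.p₂ ∘ V.p₂)   ≡⟨ cong (F ∘_) (sym V.commute) ⟩
        F ∘ (jX ∘ V.p₁)     ≡⟨ extendˡ eF ⟩
        jY ∘ (f ∘ V.p₁)     ∎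
      c = proj₁ (factors-through-jC (Q.p₁ ∘ V.p₂) PQV≡jYfV)
      jCc≡ : jC ∘ c ≡ Q.p₁ ∘ V.p₂
      jCc≡ = proj₂ (factors-through-jC (Q.p₁ ∘ V.p₂) PQV≡jYfV)
      pc≡fV : p ∘ c ≡ f ∘ V.p₁
      pc≡fV = jY-mono _ _ (begin
        jY ∘ (p ∘ c)        ≡⟨ extendˡ (sym eP) ⟩
        P ∘ (jC ∘ c)        ≡⟨ cong (P ∘_) jCc≡ ⟩
        P ∘ (Q.p₁ ∘ V.p₂)   ≡⟨ PQV≡jYfV ⟩
        jY ∘ (f ∘ V.p₁)     ∎)
      φ = K.universal c V.p₁ pc≡fV
      module W = PB (K.universal s t sq.commute) φ
      cW≡sW : c ∘ W.p₂ ≡ s ∘ W.p₁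
      cW≡sW = begin
        c ∘ W.p₂            ≡⟨ pushˡ (sym (K.universal-p₁ pc≡fV)) ⟩
        K.p₁ ∘ (φ ∘ W.p₂)   ≡⟨ cong (K.p₁ ∘_) (sym W.commute) ⟩
        K.p₁ ∘ (_ ∘ W.p₁)   ≡⟨ pullˡ (K.universal-p₁ _) ⟩
        s ∘ W.p₁            ∎
      vW≡tW : V.p₁ ∘ W.p₂ ≡ t ∘ W.p₁
      vW≡tW = begin
        V.p₁ ∘ W.p₂         ≡⟨ pushˡ (sym (K.universal-p₂ pc≡fV)) ⟩
        K.p₂ ∘ (φ ∘ W.p₂)   ≡⟨ cong (K.p₂ ∘_) (sym W.commute) ⟩
        K.p₂ ∘ (_ ∘ W.p₁)   ≡⟨ pullˡ (K.universal-p₂ _) ⟩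
        t ∘ W.p₁            ∎

  CSq-⊕ : ∀ {A C X Y A' C' X' Y'} {s : Hom A C} {p : Hom C Y} {t : Hom A X} {f : Hom X Y}
          {s' : Hom A' C'} {p' : Hom C' Y'} {t' : Hom A' X'} {f' : Hom X' Y'} →
          CSq t s f p → CSq t' s' f' p' → CSq (t ⊕′ t') (s ⊕′ s') (f ⊕′ f') (p ⊕′ p')
  CSq-⊕ {s = s} {p} {t} {f} {s'} {p'} {t'} {f'} sq sq' = record
    { commute    = commute
    ; p-cover    = Cover-⊕ (CoveringSquare.p-cover sq) (CoveringSquare.p-cover sq')
    ; comparison = Cover-from-summands V-coproduct _
        (summand-comparison-covered sq  i₁-mono ⊕-i₁ ⊕-i₁ ⊕-i₁ ⊕-i₁ commute (λ z → ⊕-factor-i₁ z p p'))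
        (summand-comparison-covered sq' i₂-mono ⊕-i₂ ⊕-i₂ ⊕-i₂ ⊕-i₂ commute (λ z → ⊕-factor-i₂ z p p'))
    }
    where
      commute : (p ⊕′ p') ∘ (s ⊕′ s') ≡ (f ⊕′ f') ∘ (t ⊕′ t')
      commute = ⊕-square (CoveringSquare.commute sq) (CoveringSquare.commute sq')
      module Q = PB (p ⊕′ p') (f ⊕′ f')
      module V₁ = PB i₁ Q.p₂
      module V₂ = PB i₂ Q.p₂
      V-coproduct : IsCoproduct 𝒞 V₁.p₂ V₂.p₂
      V-coproduct = +-stable Q.p₂ V₁.p₁ V₁.p₂ V₂.p₁ V₂.p₂ V₁.isPullback V₂.isPullback

  ∀-counit : ∀ {X Y} (f : Hom Y X) (m : SubObj 𝒞 Y) →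
             _≤ₕ_ 𝒞 (PB.p₂ (SubObj.arr (∀[ f ] m)) f) (SubObj.arr m)
  ∀-counit f m = proj₂ (∀-adjoint f m (∀[ f ] m)) ≤ₕ-refl

  ∀-elim : ∀ {X Y Z} (f : Hom Y X) (m : SubObj 𝒞 Y) {v : Hom Z Y} {x : Hom Z (SubObj.dom (∀[ f ] m))} →
           SubObj.arr (∀[ f ] m) ∘ x ≡ f ∘ v → _≤ₕ_ 𝒞 v (SubObj.arr m)
  ∀-elim f m e = ≤ₕ-trans (_ , PB.universal-p₂ _ f e) (∀-counit f m)

  -- Beck–Chevalley for ∀ along a covering square
  module _ {B E X Y} {τ : Hom B Y} {g : Hom B E} {f : Hom Y X} {ρ : Hom E X}
           (m : SubObj 𝒞 Y) (μ : SubObj 𝒞 B) (μ-inverse-image : InverseImage τ (SubObj.arr m) (SubObj.arr μ)) where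
    private
      module R = PB (SubObj.arr (∀[ f ] m)) ρ
      module τ*m = InverseImage μ-inverse-image
      w = SubObj.arr (∀[ f ] m)
      Z = SubObj.arr (∀[ g ] μ)

    ∀-pullback-≤ : ρ ∘ g ≡ f ∘ τ → _≤ₕ_ 𝒞 R.p₂ Z
    ∀-pullback-≤ commute = proj₁ (∀-adjoint g μ R-sub) (τ*m.universal V.p₂ (∀-elim f m wRV≡fτV))
      where
        R-sub : SubObj 𝒞 E
        R-sub = record { dom = R.P ; arr = R.p₂ ; mono = IsPullback-mono R.isPullback (SubObj.mono (∀[ f ] m)) }
        module V = PB R.p₂ g
        wRV≡fτV : w ∘ (R.p₁ ∘ V.p₁) ≡ f ∘ (τ ∘ V.p₂)
        wRV≡fτV = begin
          w ∘ (R.p₁ ∘ V.p₁)   ≡⟨ extendˡ R.commute ⟩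
          ρ ∘ (R.p₂ ∘ V.p₁)   ≡⟨ cong (ρ ∘_) V.commute ⟩
          ρ ∘ (g ∘ V.p₂)      ≡⟨ extendˡ commute ⟩
          f ∘ (τ ∘ V.p₂)      ∎

    -- f*(n) is covered by a map b into B with τ ∘ b landing in m.
    image-≤-∀ : ∀ {N} {e : Hom (SubObj.dom (∀[ g ] μ)) N} {n : Hom N X} → CSq τ g f ρ →
                Cover 𝒞 e → Mono 𝒞 n → ρ ∘ Z ≡ n ∘ e → _≤ₕ_ 𝒞 n w
    image-≤-∀ {e = e} {n} sq e-cover n-mono ρZ≡ne =
      proj₁ (∀-adjoint f m (record { dom = _ ; arr = n ; mono = n-mono })) f*n≤m
      where
        module sq = CoveringSquare sq
        module F' = PB n f
        module F'' = PB e F'.p₁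
        module K = PB ρ f
        ψ-commute : ρ ∘ (Z ∘ F''.p₁) ≡ f ∘ (F'.p₂ ∘ F''.p₂)
        ψ-commute = begin
          ρ ∘ (Z ∘ F''.p₁)       ≡⟨ extendˡ ρZ≡ne ⟩
          n ∘ (e ∘ F''.p₁)       ≡⟨ cong (n ∘_) F''.commute ⟩
          n ∘ (F'.p₁ ∘ F''.p₂)   ≡⟨ extendˡ F'.commute ⟩
          f ∘ (F'.p₂ ∘ F''.p₂)   ∎
        ψ = K.universal (Z ∘ F''.p₁) (F'.p₂ ∘ F''.p₂) ψ-commute
        module F₃ = PB (K.universal g τ sq.commute) ψ
        b = F₃.p₁
        Zx≡gb : Z ∘ (F''.p₁ ∘ F₃.p₂) ≡ g ∘ b
        Zx≡gb = begin
          Z ∘ (F''.p₁ ∘ F₃.p₂)   ≡⟨ sym (extendˡ (K.universal-p₁ _)) ⟩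
          K.p₁ ∘ (ψ ∘ F₃.p₂)     ≡⟨ cong (K.p₁ ∘_) (sym F₃.commute) ⟩
          K.p₁ ∘ (_ ∘ b)         ≡⟨ pullˡ (K.universal-p₁ _) ⟩
          g ∘ b                  ∎
        τb≡F'c : τ ∘ b ≡ F'.p₂ ∘ (F''.p₂ ∘ F₃.p₂)
        τb≡F'c = begin
          τ ∘ b                  ≡⟨ sym (pullˡ (K.universal-p₂ _)) ⟩
          K.p₂ ∘ (_ ∘ b)         ≡⟨ cong (K.p₂ ∘_) F₃.commute ⟩
          K.p₂ ∘ (ψ ∘ F₃.p₂)     ≡⟨ extendˡ (K.universal-p₂ _) ⟩
          F'.p₂ ∘ (F''.p₂ ∘ F₃.p₂) ∎
        τb≤m : _≤ₕ_ 𝒞 (τ ∘ b) (SubObj.arr m)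
        τb≤m = ≤ₕ-trans (∘-≤ₕ τ (∀-elim g μ Zx≡gb)) τ*m.restricts
        f*n≤m : _≤ₕ_ 𝒞 F'.p₂ (SubObj.arr m)
        f*n≤m = Cover-lift (Cover-∘ (cover-stable F₃.isPullback sq.comparison) (cover-stable F''.isPullback e-cover))
                  (SubObj.mono m) (trans (sym τb≡F'c) (sym (proj₂ τb≤m)))

    ∀-pullback-≥ : CSq τ g f ρ → _≤ₕ_ 𝒞 Z R.p₂
    ∀-pullback-≥ sq with factor (ρ ∘ Z)
    ... | _ , e , n , e-cover , n-mono , ρZ≡ne =
      R.universal (proj₁ n≤w ∘ e) Z ρZ≡wje , R.universal-p₂ ρZ≡wje
      where
        n≤w : _≤ₕ_ 𝒞 n w
        n≤w = image-≤-∀ sq e-cover n-mono ρZ≡ne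
        ρZ≡wje : w ∘ (proj₁ n≤w ∘ e) ≡ ρ ∘ Z
        ρZ≡wje = trans (pullˡ (proj₂ n≤w)) (sym ρZ≡ne)

  Scov-least : ∀ {p q} (S : MapClass 𝒞 p) (T : MapClass 𝒞 q) → IsSmallMaps 𝒞 H T →
               _⊆_ 𝒞 H S T → _⊆_ 𝒞 H (Scov 𝒞 H S) T
  Scov-least S T T-small S⊆T g (_ , _ , s , s∈S , t , q , sq) =
    a2 (IsPullback-swap K.isPullback) sq.p-cover
      (a6 _ K.p₁ sq.comparison (subst T (sym (K.universal-p₁ _)) (S⊆T s s∈S)))
    where
      open IsSmallMaps T-small
      module sq = CoveringSquare sq
      module K = PB q g

module CoveredMaps {o ℓ p} (𝒞 : Category o ℓ) (H : PositiveHeytingCategory 𝒞)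
                   (S : MapClass 𝒞 p) (S-display : IsDisplayMaps 𝒞 H S) where
  open Category 𝒞
  open PositiveHeytingCategory H
  open CategoryLemmas 𝒞
  open CoveringSquares 𝒞 H
  open IsDisplayMaps S-display

  S⊆Scov : _⊆_ 𝒞 H S (Scov 𝒞 H S)
  S⊆Scov f f∈S = _ , _ , f , f∈S , id , id , id-CSq f

  Scov-covered : ∀ {B D B' D'} {g : Hom B D} {h : Hom B' D'} {t : Hom B B'} {p : Hom D D'} →
                 Scov 𝒞 H S g → CSq t g h p → Scov 𝒞 H S h
  Scov-covered (_ , _ , s , s∈S , _ , _ , sq) sq' = _ , _ , s , s∈S , _ , _ , CSq-∘ sq sq'

  Scov-A1 : A1 𝒞 H (Scov 𝒞 H S)
  Scov-A1 pb (_ , _ , s , s∈S , _ , q , sq) with CSq-pullback sq pb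
  ... | t' , sq' = _ , _ , _ , a1 (PB.isPullback s (PB.p₁ q _)) s∈S , t' , _ , sq'

  Scov-A2 : A2 𝒞 H (Scov 𝒞 H S)
  Scov-A2 pb g-cover p₂∈Scov = Scov-covered p₂∈Scov (pullback-CSq (IsPullback-swap pb) g-cover)

  Scov-A3 : A3 𝒞 H (Scov 𝒞 H S)
  Scov-A3 _ _ (_ , _ , s , s∈S , _ , _ , sq) (_ , _ , s' , s'∈S , _ , _ , sq') =
    _ , _ , s ⊕′ s' , a3 s s' s∈S s'∈S , _ , _ , CSq-⊕ sq sq'

  Scov-A4 : A4 𝒞 H (Scov 𝒞 H S)
  Scov-A4 = S⊆Scov _ (proj₁ a4) , S⊆Scov _ (proj₁ (proj₂ a4)) , S⊆Scov _ (proj₂ (proj₂ a4))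

  -- Collection turns the cover p₀ of the domain of s into a covering square over s, along which f
  -- can be restricted.
  S-∘-Scov : ∀ {X A C} (s : Hom A C) (f : Hom X A) → S s → Scov 𝒞 H S f → Scov 𝒞 H S (s ∘ f)
  S-∘-Scov s f s∈S (_ , _ , s₀ , s₀∈S , t₀ , p₀ , sq₀) with a7 p₀ s (CoveringSquare.p-cover sq₀) s∈S
  ... | _ , _ , .(p₀ ∘ k) , g , r , g∈S , sq₁ , k , refl =
    _ , _ , g ∘ A₀'.p₂ , a5 A₀'.p₂ g (a1 A₀'.isPullback s₀∈S) g∈S , _ , _ ,
    subst (λ x → CSq (K'.p₂ ∘ u) x (s ∘ f) r) (pullʳ (K'.universal-p₁ _))
      (CSq-precompose (CSq-restrictʳ sq₁ (IsPullback-swap K'.isPullback)) (proj₂ restricted))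
    where
      module A₀' = PB s₀ k
      module K' = PB (p₀ ∘ k) f
      restricted = comparison-restrictˡ sq₀ A₀'.isPullback
      u = K'.universal A₀'.p₂ (t₀ ∘ A₀'.p₁) (proj₁ restricted)

  Scov-A5 : A5 𝒞 H (Scov 𝒞 H S)
  Scov-A5 f g f∈Scov (_ , _ , s , s∈S , t , _ , sq) =
    Scov-covered (S-∘-Scov s X.p₂ s∈S (Scov-A1 X.isPullback f∈Scov)) (CSq-restrictʳ sq X.isPullback)
    where module X = PB f t

  Scov-A6 : A6 𝒞 H (Scov 𝒞 H S)
  Scov-A6 f g f-cover gf∈Scov = Scov-covered gf∈Scov (∘-Cover-CSq f g f-cover)

  Scov-A7 : A7 𝒞 H (Scov 𝒞 H S)
  Scov-A7 q f q-cover (_ , _ , s , s∈S , t , r₀ , sq) with a7 Q.p₂ s (cover-stable Q.isPullback q-cover) s∈S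
    where module Q = PB q t
  ... | _ , _ , t' , g , r , g∈S , sq' , k , t'≡Q₂k =
    _ , _ , t ∘ t' , g , r₀ ∘ r , S⊆Scov g g∈S , CSq-∘ sq' sq , Q.p₁ ∘ k ,
    trans (cong (t ∘_) t'≡Q₂k) (sym (extendˡ Q.commute))
    where module Q = PB q t

  Bounded⇒S : ∀ {Y N} {n : Hom N Y} → Mono 𝒞 n → (m : SubObj 𝒞 Y) → Bounded 𝒞 H S m →
              _≤ₕ_ 𝒞 n (SubObj.arr m) → _≤ₕ_ 𝒞 (SubObj.arr m) n → S n
  Bounded⇒S n-mono m (_ , b , b-mono , b∈S , m≤b , b≤m) n≤m m≤n =
    a1 (IsPullback-same-subobject n-mono b-mono (≤ₕ-trans n≤m m≤b) (≤ₕ-trans b≤m m≤n)) b∈S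

  -- ρ*(∀_f m) ≅ ∀_g μ is bounded, and it covers ∀_f m since ρ is a cover.
  ∀-Scov : ∀ {X Y B E} (f : Hom Y X) (m : SubObj 𝒞 Y) {τ : Hom B Y} {g : Hom B E} {ρ : Hom E X} →
           S g → CSq τ g f ρ → (μ : SubObj 𝒞 B) → S (SubObj.arr μ) →
           InverseImage τ (SubObj.arr m) (SubObj.arr μ) → Scov 𝒞 H S (SubObj.arr (∀[ f ] m))
  ∀-Scov f m {g = g} {ρ} g∈S sq μ μ∈S μ-inverse-image =
    Scov-covered (S⊆Scov R.p₂ p₂∈S) (pullback-CSq (IsPullback-swap R.isPullback) (CoveringSquare.p-cover sq))
    where
      module R = PB (SubObj.arr (∀[ f ] m)) ρ
      p₂∈S : S R.p₂
      p₂∈S = Bounded⇒S (IsPullback-mono R.isPullback (SubObj.mono (∀[ f ] m))) (∀[ g ] μ)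
                 (a8 g μ g∈S (_ , SubObj.arr μ , SubObj.mono μ , μ∈S , ≤ₕ-refl , ≤ₕ-refl))
                 (∀-pullback-≤ m μ μ-inverse-image (CoveringSquare.commute sq))
                 (∀-pullback-≥ m μ μ-inverse-image sq)

  -- Collection along the cover pm of the domain of t gives an S-map g covering f whose top map
  -- τ factors through pm, so that τ*(m') is a pullback of the S-mono π.
  Scov-A8 : A8 𝒞 H (Scov 𝒞 H S)
  Scov-A8 f m (_ , _ , s , s∈S , t , _ , sq) (_ , m' , m'-mono , (_ , _ , sm , sm∈S , _ , pm , sqm) , m≤m' , m'≤m)
    with a7 E.p₂ s (cover-stable E.isPullback (CoveringSquare.p-cover sqm)) s∈S
    where module E = PB pm t
  ... | B , _ , t₁ , g , _ , g∈S , sq₁ , k , t₁≡E₂k =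
    _ , SubObj.arr (∀[ f ] m) , SubObj.mono (∀[ f ] m) ,
    ∀-Scov f m g∈S (CSq-∘ sq₁ sq) μ (a1 M.isPullback π∈S) (IsPullback⇒InverseImage μ-pullback m≤m' m'≤m) ,
    ≤ₕ-refl , ≤ₕ-refl
    where
      module E = PB pm t
      module Π = PB pm m'
      π-mono : Mono 𝒞 Π.p₁
      π-mono = IsPullback-mono (IsPullback-swap Π.isPullback) m'-mono
      π∈S : S Π.p₁
      π∈S = a10 _ Π.p₁ (CoveringSquare.comparison sqm) π-mono (subst S (sym (Π.universal-p₁ _)) sm∈S)
      h = E.p₁ ∘ k
      module M = PB Π.p₁ h
      μ : SubObj 𝒞 B
      μ = record { dom = M.P ; arr = M.p₂ ; mono = IsPullback-mono M.isPullback π-mono }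
      μ-pullback : IsPullback 𝒞 (t ∘ t₁) m' M.p₂ (Π.p₂ ∘ M.p₁)
      μ-pullback = IsPullback-resp (sym (trans (cong (t ∘_) t₁≡E₂k) (sym (extendˡ E.commute)))) refl refl refl
                     (IsPullback-glue Π.isPullback (IsPullback-swap M.isPullback))

  Scov-A9 : A9 𝒞 H (Scov 𝒞 H S)
  Scov-A9 X = S⊆Scov _ (a9 X)

  Scov-small : IsSmallMaps 𝒞 H (Scov 𝒞 H S)
  Scov-small = record
    { a1 = Scov-A1 ; a2 = Scov-A2 ; a3 = Scov-A3 ; a4 = Scov-A4 ; a5 = Scov-A5
    ; a6 = Scov-A6 ; a7 = Scov-A7 ; a8 = Scov-A8 ; a9 = Scov-A9 }

proposition2p14 : ∀ {o ℓ p q} (𝒞 : Category o ℓ) (H : PositiveHeytingCategory 𝒞)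
    (S : MapClass 𝒞 p) → IsDisplayMaps 𝒞 H S →
    IsSmallMaps 𝒞 H (Scov 𝒞 H S)
    × _⊆_ 𝒞 H S (Scov 𝒞 H S)
    × ((T : MapClass 𝒞 q) → IsSmallMaps 𝒞 H T → _⊆_ 𝒞 H S T → _⊆_ 𝒞 H (Scov 𝒞 H S) T)
proposition2p14 𝒞 H S S-display = Scov-small , S⊆Scov , CoveringSquares.Scov-least 𝒞 H S
  where open CoveredMaps 𝒞 H S S-display
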